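{- Assume $q>2$. Let $\wp\in\mathbb{F}_q[T]$ be a monic prime and let $s\ge 2$ be an integer. Then $\Phi(\wp^s)-q\deg(\wp^s)\ge q(q-3)$, with equality if and only if $\deg(\wp)=1$ and $s=2$.
   Context: For $m\in\mathbb{F}_q[T]$ of positive degree, $\Phi(m)$ is the number of nonzero polynomials of degree less than $\deg(m)$ relatively prime to $m$; in particular $\Phi(\wp^s)=q^{\deg(\wp^s)}-q^{\deg(\wp^{s-1})}$ for a monic prime $\wp$ and $s\ge1$. -}

module Defs where

open import Data.Nat using (ℕ; suc; _^_; _*_; _∸_; _≤_; _<_)
open import Data.Nat.Primality using (Prime)
open import Data.Product using (Σ; _×_)
open import Relation.Binary.PropositionalEquality using (_≡_)

-- q is the size of a finite field F_q: a prime power p^k with k ≥ 1.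
IsPrimePower : ℕ → Set
IsPrimePower q = Σ ℕ λ p → Σ ℕ λ k → Prime p × (1 ≤ k × q ≡ p ^ k)

-- Φ(℘^s) for a monic prime ℘ ∈ F_q[T] of degree d, via the formula given in
-- the context: Φ(℘^s) = q^{deg(℘^s)} - q^{deg(℘^{s-1})}, deg(℘^j) = d * j.
-- (The natural-number subtraction is exact since q^{d s} ≥ q^{d (s-1)}.)
ΦPrimePower : (q d s : ℕ) → ℕ
ΦPrimePower q d s = q ^ (d * s) ∸ q ^ (d * (s ∸ 1))

{-# OPTIONS --safe #-}
module Submission where

-- With n = d s and m = d (s - 1) we have m ≤ n - 1 and n ≥ 2, so
--   Φ(℘^s) - q n = q^n - q^m - q n ≥ q^n - q^(n-1) - q n = q ((q - 1) q^(n-2) - n),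
-- with equality iff m = n - 1, i.e. d = 1.  Writing n = 2 + k and p = q - 1 ≥ 2,
-- q^k ≥ 1 + k gives p q^k ≥ p + p k ≥ p + k, strictly for k ≥ 1; so the
-- right-hand side is at least q (q - 3), with equality iff n = 2.

open import Defs
open import Data.Nat using (ℕ; zero; suc; pred; _+_; _*_; _^_; _∸_; _≤_; _<_; z≤n; s≤s; z<s; _≟_)
open import Data.Nat.Properties
open import Data.Integer using (ℤ; 0ℤ; +_; _-_; _≥_; +≤+)
  renaming (_+_ to _+ℤ_; _*_ to _*ℤ_; _≤_ to _≤ℤ_)
import Data.Integer.Properties as ℤ
import Data.Integer.Tactic.RingSolver as ℤ-Solver
import Data.Nat.Tactic.RingSolver as ℕ-Solver
open import Data.Product using (_×_; _,_)
open import Data.Sum using (_⊎_; inj₁; inj₂)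
open import Function.Bundles using (_⇔_; mk⇔; Equivalence)
open import Relation.Nullary using (¬_; contradiction)
open import Relation.Nullary.Decidable using (_×-dec_; decidable-stable)
open import Relation.Binary.PropositionalEquality

n<m^n : ∀ {m} → 1 < m → ∀ n → n < m ^ n
n<m^n _ zero = z<s
n<m^n {m} 1<m@(s≤s (s≤s _)) (suc n) = begin-strict
  suc n      ≤⟨ n<m^n 1<m n ⟩
  m ^ n      <⟨ m<m*n (m ^ n) m {{m^n≢0 m n}} 1<m ⟩
  m ^ n * m  ≡⟨ *-comm (m ^ n) m ⟩
  m ^ suc n  ∎
  where open ≤-Reasoning

m+n<m*[1+m]^n : ∀ {m n} → 1 < m → 0 < n → m + n < m * suc m ^ n
m+n<m*[1+m]^n {m} {n@(suc _)} 1<m _ = begin-strict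
  m + n          <⟨ +-monoʳ-< m (m<m*n n m 1<m) ⟩
  m + n * m      ≡⟨ cong (_+_ m) (*-comm n m) ⟩
  m + m * n      ≡⟨ *-suc m n ⟨
  m * suc n      ≤⟨ *-monoʳ-≤ m (n<m^n (s≤s (<⇒≤ 1<m)) n) ⟩
  m * suc m ^ n  ∎
  where open ≤-Reasoning

m^1+m*2+m*m≡m^2+m*3 : ∀ m → m ^ 1 + m * 2 + m * m ≡ m ^ 2 + m * 3
m^1+m*2+m*m≡m^2+m*3 = unfolded
  where
  -- the ring solver does not interpret _^_
  unfolded : ∀ m → m * 1 + m * 2 + m * m ≡ m * (m * 1) + m * 3
  unfolded = ℕ-Solver.solve-∀

m^pred[n]+m*n+m*m<m^n+m*3 : ∀ {m n} → 2 < m → 2 < n →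
                            m ^ pred n + m * n + m * m < m ^ n + m * 3
m^pred[n]+m*n+m*m<m^n+m*3 {suc p} {suc (suc k)} (s≤s 1<p) (s≤s (s≤s 0<k)) =
  +-cancelʳ-< (m * (p + k)) _ _ (begin-strict
    L + m * (p + k)        <⟨ +-monoʳ-< L (*-monoʳ-< m (m+n<m*[1+m]^n 1<p 0<k)) ⟩
    L + m * (p * m ^ k)    ≡⟨ balance p k (m ^ k) ⟩
    R + m * (p + k)        ∎)
  where
  open ≤-Reasoning
  m = suc p
  L = m ^ suc k + m * suc (suc k) + m * m
  R = m ^ suc (suc k) + m * 3
  -- the inequality for n = 2 + k with both sides moved so that no subtraction occurs
  balance : ∀ p k x → let m = 1 + p in
            m * x + m * (2 + k) + m * m + m * (p * x) ≡ m * (m * x) + m * 3 + m * (p + k)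
  balance = ℕ-Solver.solve-∀

m^pred[n]+m*n+m*m≤m^n+m*3 : ∀ {m n} → 2 < m → 2 ≤ n →
                            m ^ pred n + m * n + m * m ≤ m ^ n + m * 3
m^pred[n]+m*n+m*m≤m^n+m*3 {m} 2<m 2≤n with m≤n⇒m<n∨m≡n 2≤n
... | inj₁ 2<n  = <⇒≤ (m^pred[n]+m*n+m*m<m^n+m*3 2<m 2<n)
... | inj₂ refl = ≤-reflexive (m^1+m*2+m*m≡m^2+m*3 m)

m^o+m*n+m*m≤m^n+m*3 : ∀ {m n o} → 2 < m → o < n → 2 ≤ n →
                      m ^ o + m * n + m * m ≤ m ^ n + m * 3
m^o+m*n+m*m≤m^n+m*3 {m@(suc _)} {n} {o} 2<m o<n 2≤n = begin
  m ^ o + m * n + m * m       ≤⟨ +-monoˡ-≤ (m * m) (+-monoˡ-≤ (m * n) (^-monoʳ-≤ m (<⇒≤pred o<n))) ⟩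
  m ^ pred n + m * n + m * m  ≤⟨ m^pred[n]+m*n+m*m≤m^n+m*3 2<m 2≤n ⟩
  m ^ n + m * 3               ∎
  where open ≤-Reasoning

m^o+m*n+m*m<m^n+m*3 : ∀ {m n o} → 2 < m → o < n → 2 ≤ n → suc o < n ⊎ 2 < n →
                      m ^ o + m * n + m * m < m ^ n + m * 3
m^o+m*n+m*m<m^n+m*3 {m} {n} {o} 2<m _ 2≤n (inj₁ 1+o<n) = begin-strict
  m ^ o + m * n + m * m       <⟨ +-monoˡ-< (m * m) (+-monoˡ-< (m * n) (^-monoʳ-< m (<⇒≤ 2<m) (<⇒≤pred 1+o<n))) ⟩
  m ^ pred n + m * n + m * m  ≤⟨ m^pred[n]+m*n+m*m≤m^n+m*3 2<m 2≤n ⟩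
  m ^ n + m * 3               ∎
  where open ≤-Reasoning
m^o+m*n+m*m<m^n+m*3 {m@(suc _)} {n} {o} 2<m o<n _ (inj₂ 2<n) = begin-strict
  m ^ o + m * n + m * m       ≤⟨ +-monoˡ-≤ (m * m) (+-monoˡ-≤ (m * n) (^-monoʳ-≤ m (<⇒≤pred o<n))) ⟩
  m ^ pred n + m * n + m * m  <⟨ m^pred[n]+m*n+m*m<m^n+m*3 2<m 2<n ⟩
  m ^ n + m * 3               ∎
  where open ≤-Reasoning

d*[s∸1]<d*s : ∀ {d s} → 1 ≤ d → 1 ≤ s → d * (s ∸ 1) < d * s
d*[s∸1]<d*s {d@(suc _)} {suc s} _ _ = *-monoʳ-< d (n<1+n s)

2≤d*s : ∀ {d s} → 1 ≤ d → 2 ≤ s → 2 ≤ d * s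
2≤d*s {d@(suc _)} {s} _ 2≤s = ≤-trans 2≤s (m≤n*m s d)

1+d*[s∸1]<d*s⊎2<d*s : ∀ {d s} → 1 ≤ d → 2 ≤ s → ¬ (d ≡ 1 × s ≡ 2) →
                      suc (d * (s ∸ 1)) < d * s ⊎ 2 < d * s
1+d*[s∸1]<d*s⊎2<d*s {1} {1} _ (s≤s ())
1+d*[s∸1]<d*s⊎2<d*s {1} {2} _ _ ¬tight = contradiction (refl , refl) ¬tight
1+d*[s∸1]<d*s⊎2<d*s {1} {suc (suc (suc _))} _ _ _ = inj₂ (s≤s (s≤s (s≤s z≤n)))
1+d*[s∸1]<d*s⊎2<d*s {d@(suc (suc e))} {suc s} _ _ _ =
  inj₁ (subst (suc (d * s) <_) (sym (*-suc d s)) (s≤s (s≤s (m≤n+m (d * s) e))))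

+[a∸b]-+x-c*[c-3]≡+[a+c*3]-+[b+x+c*c] : ∀ {a b} x c → b ≤ a →
  (+ (a ∸ b) - + x) - + c *ℤ (+ c - + 3) ≡ + (a + c * 3) - + (b + x + c * c)
+[a∸b]-+x-c*[c-3]≡+[a+c*3]-+[b+x+c*c] {a} {b} x c b≤a = begin
  (+ (a ∸ b) - + x) - + c *ℤ (+ c - + 3)               ≡⟨ cong (λ i → (i - + x) - + c *ℤ (+ c - + 3)) +[a∸b]≡+a-+b ⟩
  ((+ a - + b) - + x) - + c *ℤ (+ c - + 3)             ≡⟨ rearrange (+ a) (+ b) (+ x) (+ c) ⟩
  (+ a +ℤ + c *ℤ + 3) - ((+ b +ℤ + x) +ℤ + c *ℤ + c)   ≡⟨ cong₂ _-_ (+[y+z*w] a c 3) (+[y+z*w] (b + x) c c) ⟨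
  + (a + c * 3) - + (b + x + c * c)                     ∎
  where
  open ≡-Reasoning
  +[a∸b]≡+a-+b : + (a ∸ b) ≡ + a - + b
  +[a∸b]≡+a-+b = trans (sym (ℤ.⊖-≥ b≤a)) (sym (ℤ.[+m]-[+n]≡m⊖n a b))
  +[y+z*w] : ∀ y z w → + (y + z * w) ≡ + y +ℤ + z *ℤ + w
  +[y+z*w] y z w = trans (ℤ.pos-+ y (z * w)) (cong (+ y +ℤ_) (ℤ.pos-* z w))
  rearrange : ∀ a b x c → ((a - b) - x) - c *ℤ (c - + 3) ≡ (a +ℤ c *ℤ + 3) - ((b +ℤ x) +ℤ c *ℤ c)
  rearrange = ℤ-Solver.solve-∀

module _ {i j : ℤ} {a b : ℕ} (i-j≡a-b : i - j ≡ + a - + b) where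

  b≤a⇒j≤i : b ≤ a → j ≤ℤ i
  b≤a⇒j≤i b≤a = ℤ.0≤i-j⇒j≤i (subst (0ℤ ≤ℤ_) (sym i-j≡a-b) (ℤ.i≤j⇒0≤j-i (+≤+ b≤a)))

  i≡j⇔a≡b : i ≡ j ⇔ a ≡ b
  i≡j⇔a≡b = mk⇔
    (λ i≡j → ℤ.+-injective (ℤ.i-j≡0⇒i≡j (+ a) (+ b) (trans (sym i-j≡a-b) (ℤ.i≡j⇒i-j≡0 i≡j))))
    (λ a≡b → ℤ.i-j≡0⇒i≡j i j (trans i-j≡a-b (ℤ.i≡j⇒i-j≡0 (cong +_ a≡b))))

lemma6p14 : (q d s : ℕ) → IsPrimePower q → 2 < q → 1 ≤ d → 2 ≤ s →
  ((+ ΦPrimePower q d s) - (+ (q * (d * s))) ≥ (+ q) Data.Integer.* ((+ q) - (+ 3)))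
  × (((+ ΦPrimePower q d s) - (+ (q * (d * s))) ≡ (+ q) Data.Integer.* ((+ q) - (+ 3)))
     ⇔ (d ≡ 1 × s ≡ 2))
lemma6p14 q@(suc _) d s _ 2<q 1≤d 2≤s =
  b≤a⇒j≤i gap (m^o+m*n+m*m≤m^n+m*3 2<q m<n 2≤n) , mk⇔ equality⇒tight tight⇒equality
  where
  m n : ℕ
  m = d * (s ∸ 1)
  n = d * s
  m<n : m < n
  m<n = d*[s∸1]<d*s 1≤d (<⇒≤ 2≤s)
  2≤n : 2 ≤ n
  2≤n = 2≤d*s 1≤d 2≤s
  gap : (+ ΦPrimePower q d s - + (q * n)) - + q *ℤ (+ q - + 3) ≡ + (q ^ n + q * 3) - + (q ^ m + q * n + q * q)
  gap = +[a∸b]-+x-c*[c-3]≡+[a+c*3]-+[b+x+c*c] (q * n) q (^-monoʳ-≤ q (<⇒≤ m<n))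
  equality⇒tight : + ΦPrimePower q d s - + (q * n) ≡ + q *ℤ (+ q - + 3) → d ≡ 1 × s ≡ 2
  equality⇒tight equal = decidable-stable (d ≟ 1 ×-dec s ≟ 2) λ ¬tight →
    >⇒≢ (m^o+m*n+m*m<m^n+m*3 2<q m<n 2≤n (1+d*[s∸1]<d*s⊎2<d*s 1≤d 2≤s ¬tight))
        (Equivalence.to (i≡j⇔a≡b gap) equal)
  tight⇒equality : d ≡ 1 × s ≡ 2 → + ΦPrimePower q d s - + (q * n) ≡ + q *ℤ (+ q - + 3)
  tight⇒equality (refl , refl) = Equivalence.from (i≡j⇔a≡b gap) (sym (m^1+m*2+m*m≡m^2+m*3 q))
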